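{- Let $n \geq 2$, let $G_1,\ldots,G_n$ be vertex-disjoint graphs, and let $G$ be a vertex-gluing of $G_1,\ldots,G_n$ (i.e., $G$ is obtained from the disjoint union of $G_1,\ldots,G_n$ by choosing $u_i \in V(G_i)$ for each $i$ and identifying $u_1,\ldots,u_n$ as a single vertex). Then for every $m \in \mathbb{N}$, \[ P_{DP}(G,m) \leq \frac{\prod_{i=1}^{n} P_{DP}(G_i,m)}{m^{n-1}}. \]
   Context: All graphs are finite and simple. A cover of a graph $G$ is a pair $\mathcal{H}=(L,H)$ where $H$ is a graph and $L: V(G) \to \mathcal{P}(V(H))$ satisfies: (1) $\{L(u): u \in V(G)\}$ is a partition of $V(H)$ into $|V(G)|$ parts; (2) $H[L(u)]$ is complete for each $u$; (3) if there is an edge of $H$ between $L(u)$ and $L(v)$ with $u \neq v$, then $uv \in E(G)$; (4) if $uv \in E(G)$, the edges of $H$ between $L(u)$ and $L(v)$ form a (possibly empty) matching. The cover is $m$-fold if $|L(u)|=m$ for all $u$. An $\mathcal{H}$-coloring of $G$ is an independent set of $H$ of size $|V(G)|$. $P_{DP}(G,m)$ is the minimum number of $\mathcal{H}$-colorings of $G$ over all $m$-fold covers $\mathcal{H}$ of $G$. -}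

module Defs where

open import Data.Nat using (ℕ; zero; suc; _*_; _≡ᵇ_; _≤_)
open import Data.Bool using (Bool; true; false; _∧_; not)
open import Data.Fin using (Fin; _≟_)
import Data.Fin as Fin
open import Data.Fin.Subset using (Subset; ∣_∣)
open import Data.Vec using (Vec; []; _∷_; lookup)
open import Data.List using (List; []; _∷_; [_]; map; _++_; length; filter; filterᵇ; allFin)
open import Data.Bool.ListAction using (all)
open import Data.Product using (Σ; ∃; ∃₂; _×_)
open import Relation.Binary.PropositionalEquality using (_≡_; _≢_)

record Graph (k : ℕ) : Set where
  field
    adj    : Fin k → Fin k → Bool
    sym    : ∀ x y → adj x y ≡ adj y x
    irrefl : ∀ x → adj x x ≡ false
open Graph public

-- An m-fold cover (L , H) of G.  H is a graph on Fin N; the partition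
-- {L(u)} of V(H) is given by the map part : V(H) → V(G), L(u) = part⁻¹(u).
record Cover {k : ℕ} (G : Graph k) (m : ℕ) : Set where
  field
    N     : ℕ
    H     : Graph N
    part  : Fin N → Fin k
    fold  : ∀ u → length (filter (λ x → part x ≟ u) (allFin N)) ≡ m
    clique : ∀ x y → part x ≡ part y → x ≢ y → adj H x y ≡ true
    edge  : ∀ x y → part x ≢ part y → adj H x y ≡ true → adj G (part x) (part y) ≡ true
    matching : ∀ x y z → part x ≢ part y → part y ≡ part z →
               adj H x y ≡ true → adj H x z ≡ true → y ≡ z
open Cover public

allSubsets : (N : ℕ) → List (Subset N)
allSubsets zero = [ [] ]
allSubsets (suc N) = map (true ∷_) (allSubsets N) ++ map (false ∷_) (allSubsets N)

independentᵇ : {N : ℕ} → Graph N → Subset N → Bool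
independentᵇ {N} H S =
  all (λ x → all (λ y → not (lookup S x ∧ lookup S y ∧ adj H x y)) (allFin N)) (allFin N)

-- number of 𝓗-colorings of G: independent sets of H of size |V(G)| = k
numColorings : {k m : ℕ} {G : Graph k} → Cover G m → ℕ
numColorings {k} 𝓗 =
  length (filterᵇ (λ S → (∣ S ∣ ≡ᵇ k) ∧ independentᵇ (H 𝓗) S) (allSubsets (N 𝓗)))

record IsPDP {k : ℕ} (G : Graph k) (m p : ℕ) : Set₁ where
  field
    attained : Σ (Cover G m) (λ 𝓗 → numColorings 𝓗 ≡ p)
    minimal  : (𝓗 : Cover G m) → p ≤ numColorings 𝓗

∏ : (n : ℕ) → (Fin n → ℕ) → ℕ
∏ zero f = 1
∏ (suc n) f = f Fin.zero * ∏ n (λ i → f (Fin.suc i))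

-- G (on Fin k) is (isomorphic to) a vertex-gluing of the vertex-disjoint graphs
-- Gs i (on Fin (ks i)): φ i embeds Gs i into G, the chosen vertices u i are all
-- sent to the single glued vertex c, the images meet only in c, cover V(G),
-- and E(G) is exactly the union of the images of the E(Gs i).
record IsVertexGluing {n : ℕ} {ks : Fin n → ℕ} (Gs : (i : Fin n) → Graph (ks i))
                      {k : ℕ} (G : Graph k) : Set where
  field
    u      : (i : Fin n) → Fin (ks i)
    c      : Fin k
    φ      : (i : Fin n) → Fin (ks i) → Fin k
    φ-inj  : ∀ i x y → φ i x ≡ φ i y → x ≡ y
    φ-glue : ∀ i → φ i (u i) ≡ c
    φ-disj : ∀ i j x y → i ≢ j → φ i x ≡ φ j y → x ≡ u i
    φ-surj : ∀ v → ∃₂ λ i x → φ i x ≡ v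
    φ-adj  : ∀ i x y → adj G (φ i x) (φ i y) ≡ adj (Gs i) x y
    adj-in : ∀ a b → adj G a b ≡ true →
             ∃ λ i → ∃₂ λ x y → (φ i x ≡ a) × (φ i y ≡ b)

-- Fix optimal m-fold covers 𝓗ᵢ of the Gᵢ. For every shift vector s ∈ (ℤ/m)ⁿ, glue the 𝓗ᵢ into
-- an m-fold cover of G in which every fibre of the i-th part is relabelled by j ↦ sᵢ + j. A colouring
-- of the glued cover restricts to an 𝓗ᵢ-colouring for every i, and it is recovered from these
-- restrictions together with its colour j at the glued vertex; moreover the restriction to 𝓗ᵢ has
-- colour sᵢ + j at the glued vertex, so these data also recover s. Hence the mⁿ glued covers, each
-- with at least P_DP(G,m) colourings, have together at most m ∏ᵢ P_DP(Gᵢ,m) colourings.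
module Submission where

open import Data.Bool using (Bool; true; false; T; not; _∧_)
open import Data.Bool.Properties as Bool using (T?; T-∧; ¬-not; not-¬)
open import Data.Empty using (⊥-elim)
open import Data.Fin as Fin
  using (Fin; zero; suc; toℕ; cast; inject≤; combine; remQuot; quotient; remainder; finToFun; funToFin)
open import Data.Fin.Properties
  using (toℕ-injective; toℕ-fromℕ<; toℕ<n; toℕ-cast; cast-involutive; inject≤-injective; punchOut-injective;
         injective⇒≤; cantor-schröder-bernstein; any?; combine-injective; combine-remQuot; remQuot-combine;
         funToFin-finToFin)
open import Data.Fin.Subset using (Subset; ∣_∣)
open import Data.List as List using (List; length; filter; filterᵇ; allFin; lookup; map)
open import Data.List.Membership.Propositional using (_∈_)
open import Data.List.Membership.Propositional.Properties
  using (∈-lookup; ∈-filter⁺; ∈-filter⁻; ∈-allFin; ∈-map⁺; ∈-map⁻; ∈-++⁺ˡ; ∈-++⁺ʳ)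
open import Data.List.Relation.Unary.All as All using ()
open import Data.List.Relation.Unary.All.Properties using (all⁺; all⁻)
open import Data.List.Relation.Unary.AllPairs using ([]; _∷_)
open import Data.List.Relation.Unary.Any as Any using (here)
open import Data.List.Relation.Unary.Any.Properties using (lookup-index)
open import Data.List.Relation.Unary.Unique.Propositional using (Unique)
open import Data.List.Relation.Unary.Unique.Propositional.Properties using (filter⁺; allFin⁺; map⁺; ++⁺)
open import Data.Nat using (ℕ; zero; suc; _+_; _*_; _^_; _∸_; _≤_; _<_; _≡ᵇ_; s≤s; z≤n; NonZero)
open import Data.Nat.DivMod using (_%_; _mod_; %-distribˡ-+; [m+n]%n≡m%n; m<n⇒m%n≡m; m%n%n≡m%n)
open import Data.Nat.Properties
  using (+-comm; +-assoc; m∸n+n≡m; <⇒≤; <-irrefl; *-zeroʳ; *-comm; *-assoc; *-cancelˡ-≤; ≡ᵇ⇒≡; ≡⇒≡ᵇ;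
         module ≤-Reasoning)
open import Data.Product using (Σ; ∃; ∃₂; _×_; _,_; proj₁; proj₂; uncurry)
open import Data.Product.Properties using (×-≡,≡→≡)
open import Data.Sum using (_⊎_; inj₁; inj₂)
open import Data.Vec as Vec using ([]; _∷_)
open import Data.Vec.Properties using (tabulate∘lookup; lookup∘tabulate; tabulate-cong; ∷-injectiveʳ)
open import Function using (_∘_; id)
open import Function.Bundles using (Equivalence; mk⇔)
open import Function.Definitions using (Injective)
open import Level using (0ℓ)
open import Relation.Binary.PropositionalEquality
open import Relation.Nullary using (¬_; Dec; yes; no; does; ¬?; _×-dec_; _⊎-dec_)
open import Relation.Nullary.Decidable using (⌊_⌋; toWitness; fromWitness; does-⇔; dec-true; dec-false)
open import Relation.Unary using (Pred; Decidable)

open import Defs hiding (sym)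
open Graph using () renaming (sym to adj-sym)

funToFin-cong : ∀ {m n} {f g : Fin n → Fin m} → (∀ i → f i ≡ g i) → funToFin f ≡ funToFin g
funToFin-cong {n = zero}  f≗g = refl
funToFin-cong {n = suc n} f≗g = cong₂ combine (f≗g zero) (funToFin-cong (f≗g ∘ suc))

finToFun-injective : ∀ {m n} {t t′ : Fin (m ^ n)} → (∀ i → finToFun {m} {n} t i ≡ finToFun t′ i) → t ≡ t′
finToFun-injective {m} {n} {t} {t′} t≗t′ = begin
  t                              ≡⟨ funToFin-finToFin {n} {m} t ⟨
  funToFin (finToFun {m} {n} t)  ≡⟨ funToFin-cong t≗t′ ⟩
  funToFin (finToFun {m} {n} t′) ≡⟨ funToFin-finToFin {n} {m} t′ ⟩
  t′                             ∎
  where open ≡-Reasoning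

depFunToFin : ∀ {n} (ps : Fin n → ℕ) → ((i : Fin n) → Fin (ps i)) → Fin (∏ n ps)
depFunToFin {zero}  ps f = zero
depFunToFin {suc n} ps f = combine (f zero) (depFunToFin (ps ∘ suc) (f ∘ suc))

depFunToFin-injective : ∀ {n} (ps : Fin n → ℕ) {f g : (i : Fin n) → Fin (ps i)} →
                        depFunToFin ps f ≡ depFunToFin ps g → ∀ i → f i ≡ g i
depFunToFin-injective ps {f} {g} eq zero    = proj₁ (combine-injective (f zero) _ (g zero) _ eq)
depFunToFin-injective ps {f} {g} eq (suc i) =
  depFunToFin-injective (ps ∘ suc) (proj₂ (combine-injective (f zero) _ (g zero) _ eq)) i

cast-injective : ∀ {m n} .(eq : m ≡ n) {x y : Fin m} → cast eq x ≡ cast eq y → x ≡ y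
cast-injective eq {x} {y} castx≡casty =
  toℕ-injective (trans (sym (toℕ-cast eq x)) (trans (cong toℕ castx≡casty) (toℕ-cast eq y)))

injective-avoiding⇒< : ∀ {m n} {f : Fin m → Fin n} (v : Fin n) →
                       Injective _≡_ _≡_ f → (∀ a → f a ≢ v) → m < n
injective-avoiding⇒< {n = suc n} v f-injective f≢v =
  s≤s (injective⇒≤ (λ eq → f-injective (punchOut-injective (f≢v _ ∘ sym) (f≢v _ ∘ sym) eq)))

m^[1+n]*p≤m*q⇒p*m^n≤q : ∀ m .{{_ : NonZero m}} n p q → m ^ suc n * p ≤ m * q → p * m ^ n ≤ q
m^[1+n]*p≤m*q⇒p*m^n≤q m n p q m^[1+n]*p≤m*q = *-cancelˡ-≤ m (begin
  m * (p * m ^ n)  ≡⟨ cong (m *_) (*-comm p (m ^ n)) ⟩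
  m * (m ^ n * p)  ≡⟨ *-assoc m (m ^ n) p ⟨
  m ^ suc n * p    ≤⟨ m^[1+n]*p≤m*q ⟩
  m * q            ∎)
  where open ≤-Reasoning

∏-cong : ∀ n {f g : Fin n → ℕ} → (∀ i → f i ≡ g i) → ∏ n f ≡ ∏ n g
∏-cong zero    f≗g = refl
∏-cong (suc n) f≗g = cong₂ _*_ (f≗g zero) (∏-cong n (f≗g ∘ suc))

module _ {m : ℕ} .{{_ : NonZero m}} where

  infixl 6 _⊕_

  _⊕_ : Fin m → Fin m → Fin m
  a ⊕ b = (toℕ a + toℕ b) mod m

  ⊕-comm : ∀ a b → a ⊕ b ≡ b ⊕ a
  ⊕-comm a b = cong (_mod m) (+-comm (toℕ a) (toℕ b))

  -- Adding m ∸ a undoes the addition of a.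
  ⊕-cancelˡ : ∀ a {b b′} → a ⊕ b ≡ a ⊕ b′ → b ≡ b′
  ⊕-cancelˡ a {b} {b′} eq =
    toℕ-injective (trans (sym (undo b)) (trans (cong (λ r → (m ∸ toℕ a + r) % m) sums≡) (undo b′)))
    where
    sums≡ : (toℕ a + toℕ b) % m ≡ (toℕ a + toℕ b′) % m
    sums≡ = trans (sym (toℕ-fromℕ< _)) (trans (cong toℕ eq) (toℕ-fromℕ< _))
    undo : ∀ c → (m ∸ toℕ a + (toℕ a + toℕ c) % m) % m ≡ toℕ c
    undo c = begin
      (m ∸ toℕ a + (toℕ a + toℕ c) % m) % m            ≡⟨ %-distribˡ-+ (m ∸ toℕ a) _ m ⟩
      ((m ∸ toℕ a) % m + (toℕ a + toℕ c) % m % m) % m  ≡⟨ cong (λ r → ((m ∸ toℕ a) % m + r) % m) (m%n%n≡m%n _ m) ⟩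
      ((m ∸ toℕ a) % m + (toℕ a + toℕ c) % m) % m      ≡⟨ %-distribˡ-+ (m ∸ toℕ a) _ m ⟨
      (m ∸ toℕ a + (toℕ a + toℕ c)) % m                ≡⟨ cong (_% m) rearrange ⟩
      (toℕ c + m) % m                                  ≡⟨ [m+n]%n≡m%n (toℕ c) m ⟩
      toℕ c % m                                        ≡⟨ m<n⇒m%n≡m (toℕ<n c) ⟩
      toℕ c                                            ∎
      where
      open ≡-Reasoning
      rearrange : m ∸ toℕ a + (toℕ a + toℕ c) ≡ toℕ c + m
      rearrange = begin
        m ∸ toℕ a + (toℕ a + toℕ c)  ≡⟨ +-assoc (m ∸ toℕ a) (toℕ a) (toℕ c) ⟨
        m ∸ toℕ a + toℕ a + toℕ c    ≡⟨ cong (_+ toℕ c) (m∸n+n≡m (<⇒≤ (toℕ<n a))) ⟩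
        m + toℕ c                    ≡⟨ +-comm m (toℕ c) ⟩
        toℕ c + m                    ∎

  ⊕-cancelʳ : ∀ {a a′} b → a ⊕ b ≡ a′ ⊕ b → a ≡ a′
  ⊕-cancelʳ {a} {a′} b eq = ⊕-cancelˡ b (trans (⊕-comm b a) (trans eq (⊕-comm a′ b)))

lookup-injective : ∀ {A : Set} {xs : List A} → Unique xs → ∀ {i j} → lookup xs i ≡ lookup xs j → i ≡ j
lookup-injective (_    ∷ _)   {zero}  {zero}  _  = refl
lookup-injective (x∉xs ∷ _)   {zero}  {suc j} eq = ⊥-elim (All.lookup x∉xs (∈-lookup j) eq)
lookup-injective (x∉xs ∷ _)   {suc i} {zero}  eq = ⊥-elim (All.lookup x∉xs (∈-lookup i) (sym eq))
lookup-injective (_    ∷ xs!) {suc i} {suc j} eq = cong suc (lookup-injective xs! eq)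

module FilterAllFin {N : ℕ} {P : Pred (Fin N) 0ℓ} (P? : Decidable P) where

  elements : List (Fin N)
  elements = filter P? (allFin N)

  elements-unique : Unique elements
  elements-unique = filter⁺ P? (allFin⁺ N)

  lookup-satisfies : ∀ j → P (lookup elements j)
  lookup-satisfies j = proj₂ (∈-filter⁻ P? {xs = allFin N} (∈-lookup j))

  position : ∀ {x} → P x → Σ (Fin (length elements)) λ j → lookup elements j ≡ x
  position {x} px = Any.index x∈ , sym (lookup-index x∈)
    where x∈ = ∈-filter⁺ P? (∈-allFin x) px

  module _ {k : ℕ} (g : Fin N → Fin k) (g-injectiveOn : ∀ {x y} → P x → P y → g x ≡ g y → x ≡ y) where

    private
      g∘lookup : Fin (length elements) → Fin k
      g∘lookup j = g (lookup elements j)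

      g∘lookup-injective : Injective _≡_ _≡_ g∘lookup
      g∘lookup-injective eq =
        lookup-injective elements-unique (g-injectiveOn (lookup-satisfies _) (lookup-satisfies _) eq)

    onto⇒length-elements≡ : (∀ v → ∃ λ x → P x × g x ≡ v) → length elements ≡ k
    onto⇒length-elements≡ g-onto = cantor-schröder-bernstein g∘lookup-injective pick-injective
      where
      pick : Fin k → Fin (length elements)
      pick v = proj₁ (position (proj₁ (proj₂ (g-onto v))))
      pick-injective : Injective _≡_ _≡_ pick
      pick-injective {v} {w} eq = begin
        v                     ≡⟨ proj₂ (proj₂ (g-onto v)) ⟨
        g (proj₁ (g-onto v))  ≡⟨ cong g (proj₂ (position _)) ⟨
        g∘lookup (pick v)     ≡⟨ cong g∘lookup eq ⟩
        g∘lookup (pick w)     ≡⟨ cong g (proj₂ (position _)) ⟩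
        g (proj₁ (g-onto w))  ≡⟨ proj₂ (proj₂ (g-onto w)) ⟩
        w                     ∎
        where open ≡-Reasoning

    length-elements≡⇒onto : length elements ≡ k → ∀ v → ∃ λ x → P x × g x ≡ v
    length-elements≡⇒onto length≡k v with any? (λ x → P? x ×-dec (g x Fin.≟ v))
    ... | yes hit = hit
    ... | no miss = ⊥-elim (<-irrefl length≡k
      (injective-avoiding⇒< v g∘lookup-injective (λ j eq → miss (_ , lookup-satisfies j , eq))))

count-tabulate : ∀ {A : Set} {N} (q : A → Bool) (g : Fin N → A) →
                 ∣ Vec.tabulate (q ∘ g) ∣ ≡ length (filter (T? ∘ q) (List.tabulate g))
count-tabulate {N = zero}  q g = refl
count-tabulate {N = suc N} q g with q (g zero)
... | true  = cong suc (count-tabulate q (g ∘ suc))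
... | false = count-tabulate q (g ∘ suc)

∣∣≡length-filter : ∀ {N} (S : Subset N) → ∣ S ∣ ≡ length (filter (T? ∘ Vec.lookup S) (allFin N))
∣∣≡length-filter {N} S =
  subst (λ S′ → ∣ S′ ∣ ≡ length (filter (T? ∘ Vec.lookup S) (allFin N))) (tabulate∘lookup S)
        (count-tabulate (Vec.lookup S) id)

subset-ext : ∀ {N} {S S′ : Subset N} → (∀ x → Vec.lookup S x ≡ Vec.lookup S′ x) → S ≡ S′
subset-ext {S = S} {S′} S≗S′ = trans (sym (tabulate∘lookup S)) (trans (tabulate-cong S≗S′) (tabulate∘lookup S′))

∈-allSubsets : ∀ {N} (S : Subset N) → S ∈ allSubsets N
∈-allSubsets []                  = here refl
∈-allSubsets (true ∷ S)          = ∈-++⁺ˡ (∈-map⁺ (true ∷_) (∈-allSubsets S))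
∈-allSubsets {suc N} (false ∷ S) = ∈-++⁺ʳ (map (true ∷_) (allSubsets N)) (∈-map⁺ (false ∷_) (∈-allSubsets S))

allSubsets-unique : ∀ N → Unique (allSubsets N)
allSubsets-unique zero    = All.[] ∷ []
allSubsets-unique (suc N) =
  ++⁺ (map⁺ ∷-injectiveʳ (allSubsets-unique N)) (map⁺ ∷-injectiveʳ (allSubsets-unique N)) heads-differ
  where
  heads-differ : ∀ {S} → ¬ (S ∈ map (true ∷_) (allSubsets N) × S ∈ map (false ∷_) (allSubsets N))
  heads-differ (S∈ , S∈′) with ∈-map⁻ (true ∷_) S∈ | ∈-map⁻ (false ∷_) S∈′
  ... | _ , _ , refl | _ , _ , ()

T-injective : ∀ {a b} → (T a → T b) → (T b → T a) → a ≡ b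
T-injective {false} {false} _   _   = refl
T-injective {false} {true}  _   b⇒a = ⊥-elim (b⇒a _)
T-injective {true}  {false} a⇒b _   = ⊥-elim (a⇒b _)
T-injective {true}  {true}  _   _   = refl

does⇒ : ∀ {A : Set} (a? : Dec A) → does a? ≡ true → A
does⇒ (yes a) _ = a

Independent : ∀ {N} → Graph N → Subset N → Set
Independent H S = ∀ x y → T (Vec.lookup S x) → T (Vec.lookup S y) → adj H x y ≡ false

not-∧∧⇒ : ∀ a b c → T (not (a ∧ b ∧ c)) → T a → T b → c ≡ false
not-∧∧⇒ true  true  false _  _ _  = refl
not-∧∧⇒ true  true  true  () _ _
not-∧∧⇒ true  false _     _  _ ()
not-∧∧⇒ false _     _     _  () _

⇒not-∧∧ : ∀ a b c → (T a → T b → c ≡ false) → T (not (a ∧ b ∧ c))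
⇒not-∧∧ false _     _ _ = _
⇒not-∧∧ true  false _ _ = _
⇒not-∧∧ true  true  c h rewrite h _ _ = _

independentᵇ-sound : ∀ {N} (H : Graph N) S → T (independentᵇ H S) → Independent H S
independentᵇ-sound {N} H S ind x y =
  not-∧∧⇒ _ _ _ (All.lookup (all⁺ _ (allFin N) (All.lookup (all⁺ _ (allFin N) ind) (∈-allFin x))) (∈-allFin y))

independentᵇ-complete : ∀ {N} (H : Graph N) S → Independent H S → T (independentᵇ H S)
independentᵇ-complete {N} H S ind =
  all⁻ _ {allFin N} (All.tabulate λ {x} _ → all⁻ _ {allFin N} (All.tabulate λ {y} _ → ⇒not-∧∧ _ _ _ (ind x y)))

module _ {k m : ℕ} {G : Graph k} (𝓗 : Cover G m) where

  record IsColouring (S : Subset (N 𝓗)) : Set where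
    constructor isColouring
    field
      size        : ∣ S ∣ ≡ k
      independent : Independent (H 𝓗) S

  independent-part-injective : ∀ {S} → Independent (H 𝓗) S → ∀ {x y} →
                               T (Vec.lookup S x) → T (Vec.lookup S y) → part 𝓗 x ≡ part 𝓗 y → x ≡ y
  independent-part-injective ind {x} {y} x∈ y∈ same-part with x Fin.≟ y
  ... | yes x≡y = x≡y
  ... | no  x≢y with () ← trans (sym (clique 𝓗 x y same-part x≢y)) (ind x y x∈ y∈)

  colouring-meets-fibre : ∀ {S} → IsColouring S → ∀ v → ∃ λ x → T (Vec.lookup S x) × part 𝓗 x ≡ v
  colouring-meets-fibre {S} (isColouring ∣S∣≡k ind) =
    length-elements≡⇒onto (part 𝓗) (independent-part-injective {S} ind) (trans (sym (∣∣≡length-filter S)) ∣S∣≡k)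
    where open FilterAllFin (T? ∘ Vec.lookup S)

  module Fibres where

    module Fibre (v : Fin k) = FilterAllFin (λ x → part 𝓗 x Fin.≟ v)

    vertex : Fin k → Fin m → Fin (N 𝓗)
    vertex v j = lookup (Fibre.elements v) (cast (sym (fold 𝓗 v)) j)

    label : Fin (N 𝓗) → Fin m
    label x = cast (fold 𝓗 (part 𝓗 x)) (proj₁ (Fibre.position (part 𝓗 x) refl))

    part-vertex : ∀ v j → part 𝓗 (vertex v j) ≡ v
    part-vertex v j = Fibre.lookup-satisfies v _

    vertex-injective : ∀ v {j j′} → vertex v j ≡ vertex v j′ → j ≡ j′
    vertex-injective v eq = cast-injective (sym (fold 𝓗 v)) (lookup-injective (Fibre.elements-unique v) eq)

    vertex-part-label : ∀ x → vertex (part 𝓗 x) (label x) ≡ x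
    vertex-part-label x = trans (cong (lookup (Fibre.elements (part 𝓗 x))) (cast-involutive (sym fold-x) fold-x _))
                                (proj₂ (Fibre.position (part 𝓗 x) refl))
      where fold-x = fold 𝓗 (part 𝓗 x)

    label-vertex : ∀ v j → label (vertex v j) ≡ j
    label-vertex v j = vertex-injective v (vertex-label (part-vertex v j))
      where
      vertex-label : ∀ {v′} → part 𝓗 (vertex v j) ≡ v′ → vertex v′ (label (vertex v j)) ≡ vertex v j
      vertex-label refl = vertex-part-label (vertex v j)

    part-label-injective : ∀ {x y} → part 𝓗 x ≡ part 𝓗 y → label x ≡ label y → x ≡ y
    part-label-injective {x} {y} same-part same-label =
      trans (sym (vertex-part-label x)) (trans (cong₂ vertex same-part same-label) (vertex-part-label y))

    choiceSubset : (Fin k → Fin m) → Subset (N 𝓗)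
    choiceSubset f = Vec.tabulate λ x → ⌊ label x Fin.≟ f (part 𝓗 x) ⌋

    module _ (f : Fin k → Fin m) where

      ∈-choiceSubset⁻ : ∀ {x} → T (Vec.lookup (choiceSubset f) x) → label x ≡ f (part 𝓗 x)
      ∈-choiceSubset⁻ {x} x∈ = toWitness (subst T (lookup∘tabulate _ x) x∈)

      vertex-∈-choiceSubset : ∀ v → T (Vec.lookup (choiceSubset f) (vertex v (f v)))
      vertex-∈-choiceSubset v = subst T (sym (lookup∘tabulate _ (vertex v (f v))))
        (fromWitness (trans (label-vertex v (f v)) (cong f (sym (part-vertex v (f v))))))

      ∣choiceSubset∣ : ∣ choiceSubset f ∣ ≡ k
      ∣choiceSubset∣ =
        trans (∣∣≡length-filter (choiceSubset f)) (onto⇒length-elements≡ (part 𝓗) part-injectiveOn onto)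
        where
        open FilterAllFin (T? ∘ Vec.lookup (choiceSubset f))
        part-injectiveOn : ∀ {x y} → T (Vec.lookup (choiceSubset f) x) → T (Vec.lookup (choiceSubset f) y) →
                           part 𝓗 x ≡ part 𝓗 y → x ≡ y
        part-injectiveOn x∈ y∈ same-part = part-label-injective same-part
          (trans (∈-choiceSubset⁻ x∈) (trans (cong f same-part) (sym (∈-choiceSubset⁻ y∈))))
        onto : ∀ v → ∃ λ x → T (Vec.lookup (choiceSubset f) x) × part 𝓗 x ≡ v
        onto v = vertex v (f v) , vertex-∈-choiceSubset v , part-vertex v (f v)

    choiceSubset-injective : ∀ {f g} → choiceSubset f ≡ choiceSubset g → ∀ v → f v ≡ g v
    choiceSubset-injective {f} {g} eq v = begin
      f v                          ≡⟨ label-vertex v (f v) ⟨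
      label (vertex v (f v))       ≡⟨ ∈-choiceSubset⁻ g (subst (λ S → T (Vec.lookup S (vertex v (f v)))) eq
                                                               (vertex-∈-choiceSubset f v)) ⟩
      g (part 𝓗 (vertex v (f v)))  ≡⟨ cong g (part-vertex v (f v)) ⟩
      g v                          ∎
      where open ≡-Reasoning

  isColouringᵇ : Subset (N 𝓗) → Bool
  isColouringᵇ S = (∣ S ∣ ≡ᵇ k) ∧ independentᵇ (H 𝓗) S

  colouring : Fin (numColorings 𝓗) → Subset (N 𝓗)
  colouring = lookup (filterᵇ isColouringᵇ (allSubsets (N 𝓗)))

  colouring-isColouring : ∀ t → IsColouring (colouring t)
  colouring-isColouring t =
    isColouring (≡ᵇ⇒≡ _ _ (proj₁ size×ind)) (independentᵇ-sound (H 𝓗) (colouring t) (proj₂ size×ind))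
    where
    size×ind = Equivalence.to T-∧ (proj₂ (∈-filter⁻ (T? ∘ isColouringᵇ) {xs = allSubsets (N 𝓗)} (∈-lookup t)))

  colouring-injective : Injective _≡_ _≡_ colouring
  colouring-injective = lookup-injective (filter⁺ (T? ∘ isColouringᵇ) (allSubsets-unique (N 𝓗)))

  colouring-surjective : ∀ {S} → IsColouring S → ∃ λ t → colouring t ≡ S
  colouring-surjective {S} (isColouring ∣S∣≡k ind) = Any.index S∈ , sym (lookup-index S∈)
    where
    S∈ = ∈-filter⁺ (T? ∘ isColouringᵇ) (∈-allSubsets S)
           (Equivalence.from T-∧ (≡⇒≡ᵇ _ _ ∣S∣≡k , independentᵇ-complete (H 𝓗) S ind))

module Gluing {n : ℕ} {ks : Fin n → ℕ} {Gs : (i : Fin n) → Graph (ks i)} {k : ℕ} {G : Graph k}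
              (gl : IsVertexGluing Gs G) {m : ℕ} .{{_ : NonZero m}} (𝓗s : (i : Fin n) → Cover (Gs i) m) where

  open IsVertexGluing gl

  module 𝓗 (i : Fin n) = Fibres (𝓗s i)

  component-unique : ∀ {a b i i′ x y x′ y′} → a ≢ b →
                     φ i x ≡ a → φ i y ≡ b → φ i′ x′ ≡ a → φ i′ y′ ≡ b → i ≡ i′
  component-unique {a} {b} {i} {i′} {x} {y} a≢b φx φy φx′ φy′ with i Fin.≟ i′
  ... | yes i≡i′ = i≡i′
  ... | no  i≢i′ = ⊥-elim (a≢b (begin
    a          ≡⟨ φx ⟨
    φ i x      ≡⟨ cong (φ i) (φ-disj i i′ x _ i≢i′ (trans φx (sym φx′))) ⟩
    φ i (u i)  ≡⟨ cong (φ i) (φ-disj i i′ y _ i≢i′ (trans φy (sym φy′))) ⟨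
    φ i y      ≡⟨ φy ⟩
    b          ∎))
    where open ≡-Reasoning

  Point : Set
  Point = Fin k × Fin m

  toPoint : Fin (k * m) → Point
  toPoint = remQuot {k} m

  toPoint-injective : ∀ {z z′} → toPoint z ≡ toPoint z′ → z ≡ z′
  toPoint-injective {z} {z′} eq =
    trans (sym (combine-remQuot {k} m z)) (trans (cong (uncurry combine) eq) (combine-remQuot {k} m z′))

  module _ (s : Fin n → Fin m) where

    shiftedVertex : (i : Fin n) → Fin (ks i) → Fin m → Fin (N (𝓗s i))
    shiftedVertex i x j = 𝓗.vertex i x (s i ⊕ j)

    shiftedVertex-parts-differ : ∀ {i x y j j′} → φ i x ≢ φ i y →
                                 part (𝓗s i) (shiftedVertex i x j) ≢ part (𝓗s i) (shiftedVertex i y j′)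
    shiftedVertex-parts-differ {i} {x} {y} φx≢φy same-part =
      φx≢φy (cong (φ i) (trans (sym (𝓗.part-vertex i x _)) (trans same-part (𝓗.part-vertex i y _))))

    Edge : Point → Point → Set
    Edge (a , j) (b , j′) = ∃ λ i → ∃₂ λ x y → φ i x ≡ a × φ i y ≡ b ×
                              adj (H (𝓗s i)) (shiftedVertex i x j) (shiftedVertex i y j′) ≡ true

    Adjacent : Point → Point → Set
    Adjacent (a , j) (b , j′) = (a ≡ b × j ≢ j′) ⊎ (a ≢ b × Edge (a , j) (b , j′))

    adjacent? : ∀ p q → Dec (Adjacent p q)
    adjacent? (a , j) (b , j′) = ((a Fin.≟ b) ×-dec ¬? (j Fin.≟ j′)) ⊎-dec (¬? (a Fin.≟ b) ×-dec edge?)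
      where
      edge? = any? λ i → any? λ x → any? λ y → (φ i x Fin.≟ a) ×-dec (φ i y Fin.≟ b) ×-dec
                (adj (H (𝓗s i)) (shiftedVertex i x j) (shiftedVertex i y j′) Bool.≟ true)

    Adjacent-sym : ∀ {p q} → Adjacent p q → Adjacent q p
    Adjacent-sym (inj₁ (a≡b , j≢j′)) = inj₁ (sym a≡b , j≢j′ ∘ sym)
    Adjacent-sym (inj₂ (a≢b , i , x , y , φx , φy , adjXY)) =
      inj₂ (a≢b ∘ sym , i , y , x , φy , φx , trans (adj-sym (H (𝓗s i)) _ _) adjXY)

    Adjacent-irrefl : ∀ {p} → ¬ Adjacent p p
    Adjacent-irrefl (inj₁ (_ , j≢j)) = j≢j refl
    Adjacent-irrefl (inj₂ (a≢a , _)) = a≢a refl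

    Adjacent⇒Edge : ∀ {p q} → proj₁ p ≢ proj₁ q → Adjacent p q → Edge p q
    Adjacent⇒Edge a≢b (inj₁ (a≡b , _)) = ⊥-elim (a≢b a≡b)
    Adjacent⇒Edge a≢b (inj₂ (_ , e))   = e

    -- Two edges from the same point into one fibre live in the same 𝓗ᵢ, where they form a matching.
    Edge-functional : ∀ {a b j j₁ j₂} → a ≢ b → Edge (a , j) (b , j₁) → Edge (a , j) (b , j₂) → j₁ ≡ j₂
    Edge-functional a≢b (i , x , y , φx , φy , adj₁) (i′ , x′ , y′ , φx′ , φy′ , adj₂)
      with refl ← component-unique a≢b φx φy φx′ φy′
      with refl ← φ-inj i x x′ (trans φx (sym φx′)) | refl ← φ-inj i y y′ (trans φy (sym φy′)) =
      ⊕-cancelˡ (s i) (𝓗.vertex-injective i y (matching (𝓗s i) _ _ _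
        (shiftedVertex-parts-differ (λ φx≡φy → a≢b (trans (sym φx) (trans φx≡φy φy))))
        (trans (𝓗.part-vertex i y _) (sym (𝓗.part-vertex i y _))) adj₁ adj₂))

    Edge⇒adj : ∀ {a b j j′} → a ≢ b → Edge (a , j) (b , j′) → adj G a b ≡ true
    Edge⇒adj a≢b (i , x , y , refl , refl , adjXY) = trans (φ-adj i x y)
      (subst₂ (λ x′ y′ → adj (Gs i) x′ y′ ≡ true) (𝓗.part-vertex i x _) (𝓗.part-vertex i y _)
              (edge (𝓗s i) _ _ (shiftedVertex-parts-differ a≢b) adjXY))

    gluedGraph : Graph (k * m)
    gluedGraph = record
      { adj    = λ z z′ → does (adjacent? (toPoint z) (toPoint z′))
      ; sym    = λ z z′ → does-⇔ (mk⇔ Adjacent-sym Adjacent-sym)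
                                   (adjacent? (toPoint z) (toPoint z′)) (adjacent? (toPoint z′) (toPoint z))
      ; irrefl = λ z → dec-false (adjacent? (toPoint z) _) Adjacent-irrefl
      }

    gluedCover : Cover G m
    gluedCover = record
      { N        = k * m
      ; H        = gluedGraph
      ; part     = quotient {k} m
      ; fold     = fibre-size
      ; clique   = λ z z′ same-part z≢z′ → dec-true (adjacent? (toPoint z) _)
                     (inj₁ (same-part , z≢z′ ∘ toPoint-injective ∘ ×-≡,≡→≡ ∘ (same-part ,_)))
      ; edge     = λ z z′ parts-differ adjzz′ →
                     Edge⇒adj parts-differ (Adjacent⇒Edge parts-differ (adjacent z z′ adjzz′))
      ; matching = matches
      }
      where
      fibre-size : ∀ a → length (filter (λ z → quotient {k} m z Fin.≟ a) (allFin (k * m))) ≡ m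
      fibre-size a = onto⇒length-elements≡ (remainder {k} m)
        (λ same-part same-part′ same-label →
           toPoint-injective (×-≡,≡→≡ (trans same-part (sym same-part′) , same-label)))
        (λ j → combine a j , cong proj₁ (remQuot-combine a j) , cong proj₂ (remQuot-combine a j))
        where open FilterAllFin (λ z → quotient {k} m z Fin.≟ a)
      adjacent : ∀ z z′ → does (adjacent? (toPoint z) (toPoint z′)) ≡ true → Adjacent (toPoint z) (toPoint z′)
      adjacent z z′ = does⇒ (adjacent? (toPoint z) (toPoint z′))
      matches : ∀ z y w → quotient {k} m z ≢ quotient {k} m y → quotient {k} m y ≡ quotient {k} m w →
                does (adjacent? (toPoint z) (toPoint y)) ≡ true →
                does (adjacent? (toPoint z) (toPoint w)) ≡ true → y ≡ w
      matches z y w z≁y y∼w adjzy adjzw = toPoint-injective (×-≡,≡→≡ (y∼w , Edge-functional z≁y edge₁ edge₂))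
        where
        edge₁ = Adjacent⇒Edge z≁y (adjacent z y adjzy)
        edge₂ = subst (λ b → Edge (toPoint z) (b , remainder {k} m w)) (sym y∼w)
                      (Adjacent⇒Edge (λ z∼w → z≁y (trans z∼w (sym y∼w))) (adjacent z w adjzw))

    Adjacent⇒adj : ∀ {a j b j′} → Adjacent (a , j) (b , j′) → adj gluedGraph (combine a j) (combine b j′) ≡ true
    Adjacent⇒adj {a} {j} {b} {j′} a∼b = dec-true (adjacent? (toPoint (combine a j)) (toPoint (combine b j′)))
      (subst₂ Adjacent (sym (remQuot-combine a j)) (sym (remQuot-combine b j′)) a∼b)

    module Decoding {S : Subset (k * m)} (S-colouring : IsColouring gluedCover S) where

      private
        meets = colouring-meets-fibre gluedCover S-colouring

      colour : Fin k → Fin m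
      colour a = remainder {k} m (proj₁ (meets a))

      ∈⇒colour : ∀ {z} → T (Vec.lookup S z) → remainder {k} m z ≡ colour (quotient {k} m z)
      ∈⇒colour z∈ = cong (remainder {k} m) (independent-part-injective gluedCover {S}
        (IsColouring.independent S-colouring) z∈ (proj₁ (proj₂ (meets _))) (sym (proj₂ (proj₂ (meets _)))))

      colour⇒∈ : ∀ {z} → remainder {k} m z ≡ colour (quotient {k} m z) → T (Vec.lookup S z)
      colour⇒∈ z-coloured = subst (T ∘ Vec.lookup S)
        (toPoint-injective (×-≡,≡→≡ (proj₂ (proj₂ (meets _)) , sym z-coloured))) (proj₁ (proj₂ (meets _)))

      colour-∈ : ∀ a → T (Vec.lookup S (combine a (colour a)))
      colour-∈ a = colour⇒∈ (trans (cong proj₂ (remQuot-combine a (colour a)))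
                                   (cong colour (sym (cong proj₁ (remQuot-combine a (colour a))))))

      restriction : (i : Fin n) → Fin (ks i) → Fin m
      restriction i v = s i ⊕ colour (φ i v)

      restriction-independent : ∀ i → Independent (H (𝓗s i)) (𝓗.choiceSubset i (restriction i))
      restriction-independent i x y x∈ y∈ with part (𝓗s i) x Fin.≟ part (𝓗s i) y
      ... | yes same-part = subst (λ y′ → adj (H (𝓗s i)) x y′ ≡ false) x≡y (irrefl (H (𝓗s i)) x)
        where
        x≡y : x ≡ y
        x≡y = 𝓗.part-label-injective i same-part (trans (𝓗.∈-choiceSubset⁻ i (restriction i) x∈)
                (trans (cong (restriction i) same-part) (sym (𝓗.∈-choiceSubset⁻ i (restriction i) y∈))))
      ... | no parts-differ = ¬-not λ adjxy →
        not-¬ (IsColouring.independent S-colouring _ _ (colour-∈ _) (colour-∈ _))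
              (Adjacent⇒adj (points-adjacent adjxy))
        where
        lifts : ∀ {z} → T (Vec.lookup (𝓗.choiceSubset i (restriction i)) z) →
                shiftedVertex i (part (𝓗s i) z) (colour (φ i (part (𝓗s i) z))) ≡ z
        lifts {z} z∈ = trans (cong (𝓗.vertex i (part (𝓗s i) z)) (sym (𝓗.∈-choiceSubset⁻ i (restriction i) z∈)))
                             (𝓗.vertex-part-label i z)
        points-adjacent : adj (H (𝓗s i)) x y ≡ true →
                          Adjacent (φ i (part (𝓗s i) x) , _) (φ i (part (𝓗s i) y) , _)
        points-adjacent adjxy = inj₂ (parts-differ ∘ φ-inj i _ _ , i , _ , _ , refl , refl ,
                                      trans (cong₂ (adj (H (𝓗s i))) (lifts x∈) (lifts y∈)) adjxy)

      restriction-isColouring : ∀ i → IsColouring (𝓗s i) (𝓗.choiceSubset i (restriction i))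
      restriction-isColouring i = isColouring (𝓗.∣choiceSubset∣ i (restriction i)) (restriction-independent i)

  module _ {s s′ S S′} (S-colouring : IsColouring (gluedCover s) S)
           (S′-colouring : IsColouring (gluedCover s′) S′) where

    private
      module X = Decoding s S-colouring
      module X′ = Decoding s′ S′-colouring

    -- The restriction to 𝓗ᵢ has colour sᵢ ⊕ colour c at the glued vertex, which recovers sᵢ.
    decoding-injective : X.colour c ≡ X′.colour c →
                         (∀ i → 𝓗.choiceSubset i (X.restriction i) ≡ 𝓗.choiceSubset i (X′.restriction i)) →
                         (∀ i → s i ≡ s′ i) × S ≡ S′
    decoding-injective same-colour same-restriction = shifts≡ , colourings≡
      where
      restrictions≡ : ∀ i v → s i ⊕ X.colour (φ i v) ≡ s′ i ⊕ X′.colour (φ i v)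
      restrictions≡ i = 𝓗.choiceSubset-injective i (same-restriction i)
      shifts≡ : ∀ i → s i ≡ s′ i
      shifts≡ i = ⊕-cancelʳ (X.colour c) (begin
        s i ⊕ X.colour c              ≡⟨ cong (λ a → s i ⊕ X.colour a) (φ-glue i) ⟨
        s i ⊕ X.colour (φ i (u i))    ≡⟨ restrictions≡ i (u i) ⟩
        s′ i ⊕ X′.colour (φ i (u i))  ≡⟨ cong (λ a → s′ i ⊕ X′.colour a) (φ-glue i) ⟩
        s′ i ⊕ X′.colour c            ≡⟨ cong (s′ i ⊕_) same-colour ⟨
        s′ i ⊕ X.colour c             ∎)
        where open ≡-Reasoning
      colours≡ : ∀ a → X.colour a ≡ X′.colour a
      colours≡ a with i , v , refl ← φ-surj a =
        ⊕-cancelˡ (s i) (trans (restrictions≡ i v) (cong (_⊕ X′.colour (φ i v)) (sym (shifts≡ i))))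
      colourings≡ : S ≡ S′
      colourings≡ = subset-ext λ z → T-injective
        (λ z∈  → X′.colour⇒∈ (trans (X.∈⇒colour z∈) (colours≡ _)))
        (λ z∈′ → X.colour⇒∈ (trans (X′.∈⇒colour z∈′) (sym (colours≡ _))))

module _ {n : ℕ} {ks : Fin n → ℕ} {Gs : (i : Fin n) → Graph (ks i)} {k : ℕ} {G : Graph k}
         (gl : IsVertexGluing Gs G) {m : ℕ} .{{_ : NonZero m}} (𝓗s : (i : Fin n) → Cover (Gs i) m)
         {p : ℕ} (p-minimal : (𝓒 : Cover G m) → p ≤ numColorings 𝓒) where

  open Gluing gl 𝓗s
  open IsVertexGluing gl using (c)

  module Chosen (t : Fin (m ^ n)) (j : Fin p) where

    shift : Fin n → Fin m
    shift = finToFun {m} {n} t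

    index : Fin (numColorings (gluedCover shift))
    index = inject≤ j (p-minimal (gluedCover shift))

    open Decoding shift (colouring-isColouring (gluedCover shift) index) public

    restrictionIndex : (i : Fin n) → Fin (numColorings (𝓗s i))
    restrictionIndex i = proj₁ (colouring-surjective (𝓗s i) (restriction-isColouring i))

    encoding : Fin (m * ∏ n (numColorings ∘ 𝓗s))
    encoding = combine (colour c) (depFunToFin (numColorings ∘ 𝓗s) restrictionIndex)

  encoding-decodes : ∀ {t j t′ j′} → Chosen.encoding t j ≡ Chosen.encoding t′ j′ →
                     (∀ i → finToFun {m} {n} t i ≡ finToFun {m} {n} t′ i) ×
                     colouring (gluedCover (finToFun t)) (Chosen.index t j) ≡
                     colouring (gluedCover (finToFun t′)) (Chosen.index t′ j′)
  encoding-decodes {t} {j} {t′} {j′} eq =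
    decoding-injective {X.shift} {X′.shift} (colouring-isColouring (gluedCover X.shift) X.index)
      (colouring-isColouring (gluedCover X′.shift) X′.index) same-colour same-restriction
    where
    module X = Chosen t j
    module X′ = Chosen t′ j′
    same-colour : X.colour c ≡ X′.colour c
    same-colour = proj₁ (combine-injective (X.colour c) _ (X′.colour c) _ eq)
    same-indices : ∀ i → X.restrictionIndex i ≡ X′.restrictionIndex i
    same-indices = depFunToFin-injective _ (proj₂ (combine-injective (X.colour c) _ (X′.colour c) _ eq))
    same-restriction : ∀ i → 𝓗.choiceSubset i (X.restriction i) ≡ 𝓗.choiceSubset i (X′.restriction i)
    same-restriction i = begin
      𝓗.choiceSubset i (X.restriction i)       ≡⟨ proj₂ (colouring-surjective (𝓗s i) (X.restriction-isColouring i)) ⟨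
      colouring (𝓗s i) (X.restrictionIndex i)   ≡⟨ cong (colouring (𝓗s i)) (same-indices i) ⟩
      colouring (𝓗s i) (X′.restrictionIndex i)  ≡⟨ proj₂ (colouring-surjective (𝓗s i) (X′.restriction-isColouring i)) ⟩
      𝓗.choiceSubset i (X′.restriction i)      ∎
      where open ≡-Reasoning

  encoding-injective : ∀ {t j t′ j′} → Chosen.encoding t j ≡ Chosen.encoding t′ j′ → (t , j) ≡ (t′ , j′)
  encoding-injective {t} {j} {t′} {j′} eq = ×-≡,≡→≡ (t≡t′ , j≡j′)
    where
    t≡t′ : t ≡ t′
    t≡t′ = finToFun-injective (proj₁ (encoding-decodes eq))
    j≡j′ : j ≡ j′
    j≡j′ = inject≤-injective _ _ j j′ (colouring-injective (gluedCover (finToFun t))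
             (proj₂ (encoding-decodes (subst (λ t″ → Chosen.encoding t j ≡ Chosen.encoding t″ j′) (sym t≡t′) eq))))

  -- Stated with an explicit λ: naming the composite makes the type checker unfold the list of colourings.
  gluedColourings-bound : m ^ n * p ≤ m * ∏ n (numColorings ∘ 𝓗s)
  gluedColourings-bound =
    injective⇒≤ {f = λ w → Chosen.encoding (quotient {m ^ n} p w) (remainder {m ^ n} p w)} λ {w} {w′} eq → begin
      w                                                        ≡⟨ combine-remQuot {m ^ n} p w ⟨
      combine (quotient {m ^ n} p w) (remainder {m ^ n} p w)   ≡⟨ cong (uncurry combine) (encoding-injective
        {quotient {m ^ n} p w} {remainder {m ^ n} p w} {quotient {m ^ n} p w′} {remainder {m ^ n} p w′} eq) ⟩
      combine (quotient {m ^ n} p w′) (remainder {m ^ n} p w′) ≡⟨ combine-remQuot {m ^ n} p w′ ⟩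
      w′                                                       ∎
    where open ≡-Reasoning

theorem1p10 : (n : ℕ) → 2 ≤ n →
    (ks : Fin n → ℕ) (Gs : (i : Fin n) → Graph (ks i)) →
    (k : ℕ) (G : Graph k) → IsVertexGluing Gs G →
    (m p : ℕ) (ps : Fin n → ℕ) →
    IsPDP G m p → ((i : Fin n) → IsPDP (Gs i) m (ps i)) →
    p * m ^ (n ∸ 1) ≤ ∏ n ps
theorem1p10 (suc (suc n)) (s≤s (s≤s _)) ks Gs k G gl zero p ps _ _ =
  subst (_≤ ∏ (suc (suc n)) ps) (sym (*-zeroʳ p)) z≤n
theorem1p10 (suc (suc n)) _ ks Gs k G gl m@(suc _) p ps G-pdp Gs-pdp =
  m^[1+n]*p≤m*q⇒p*m^n≤q m (suc n) p (∏ (suc (suc n)) ps)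
    (subst (λ q → m ^ suc (suc n) * p ≤ m * q) (∏-cong (suc (suc n)) (proj₂ ∘ IsPDP.attained ∘ Gs-pdp))
           (gluedColourings-bound gl 𝓗s (IsPDP.minimal G-pdp)))
  where
  𝓗s : (i : Fin (suc (suc n))) → Cover (Gs i) m
  𝓗s = proj₁ ∘ IsPDP.attained ∘ Gs-pdp
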